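{- Let $G=(V,E)$ be a tree, $k\in\mathbb N$, and $f:E\to\{0,\dots,k\}$ an arbitrary labeling. Fix an arbitrary root of $G$ and orient all edges away from it. Then $f$ is a valid labeling if and only if (1) for every $u\in V$, if $e=(u',u)\in E$ is the edge entering $u$, then $f(e)\notin S(u)$ or $f(e)=0$ (or both); and (2) for every $u\in V$ and distinct edges $e,e'\in\delta^+(u)$, the sets $L(e)$ and $L(e')$ are disjoint except possibly for the label $0$.
   Context: A labeling $f:E\to\{0,\dots,k\}$ is valid if for every pair of distinct edges $e_1,e_2$ with $f(e_1)=f(e_2)>0$ there is an edge $e_3$ on the simple path between $e_1$ and $e_2$ with $f(e_3)>f(e_1)$. In the oriented (out-)tree, an edge from $u$ to $v$ is written $(u,v)$ and $\delta^+(u)$ is the set of edges leaving $u$. An edge $e'$ is visible from edge $e$ if on the directed path starting with $e$ and ending with $e'$ there is no edge $e''\ne e'$ with $f(e'')>f(e')$. The visibility sequence $L(e)$ is the ascending enumeration of the labels $f(e')$ of edges $e'$ visible from $e$ (its first element is $f(e)$). The visibility sequence of a vertex $u$ is $S(u)=\bigcup_{e\in\delta^+(u)}L(e)$. -}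

module Defs where

open import Data.Nat using (ℕ; zero; suc; _≤_; _<_)
open import Data.Fin using (Fin; zero; suc; toℕ)
open import Data.List using (List; []; _∷_; head; last)
open import Data.List.Relation.Unary.Unique.Propositional using (Unique)
open import Data.List.Membership.Propositional using (_∈_)
open import Data.Maybe using (Maybe; just)
open import Data.Product using (Σ; ∃; _×_; _,_)
open import Data.Sum using (_⊎_)
open import Relation.Binary.PropositionalEquality using (_≡_; _≢_)
open import Relation.Nullary using (¬_)

-- A rooted tree with vertex set Fin (suc n), root = zero.
-- The non-root vertex (suc i) has parent (par i); the edge i : Fin n is the
-- oriented edge (par i , suc i) (directed away from the root).
-- Acyclicity / being a tree is the hypothesis  toℕ (par i) ≤ toℕ i
-- (every parent has a smaller index), imposed in the theorem.
IsParentArray : ∀ {n} → (Fin n → Fin (suc n)) → Set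
IsParentArray {n} par = (i : Fin n) → toℕ (par i) ≤ toℕ i

module Tree {n : ℕ} (par : Fin n → Fin (suc n)) (f : Fin n → ℕ) where

  V : Set
  V = Fin (suc n)

  E : Set
  E = Fin n

  Joins : E → V → V → Set
  Joins e u v = (par e ≡ u × suc e ≡ v) ⊎ (par e ≡ v × suc e ≡ u)

  data Walk : V → V → Set where
    stop : (v : V) → Walk v v
    step : ∀ {u v w} (e : E) → Joins e u v → Walk v w → Walk u w

  verts : ∀ {u w} → Walk u w → List V
  verts (stop v) = v ∷ []
  verts (step {u} e _ W) = u ∷ verts W

  edgesW : ∀ {u w} → Walk u w → List E
  edgesW (stop v) = []
  edgesW (step e _ W) = e ∷ edgesW W

  record SimplePath (e₁ e₂ : E) : Set where
    field
      start end : V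
      walk      : Walk start end
      simple    : Unique (verts walk)
      first     : head (edgesW walk) ≡ just e₁
      final     : last (edgesW walk) ≡ just e₂

  Valid : Set
  Valid = (e₁ e₂ : E) → e₁ ≢ e₂ → f e₁ ≡ f e₂ → 0 < f e₁ →
          (P : SimplePath e₁ e₂) →
          ∃ λ e₃ → e₃ ∈ edgesW (SimplePath.walk P) × f e₁ < f e₃

  data DPath : E → E → Set where
    one  : (e : E) → DPath e e
    more : ∀ {e e₁ e'} → par e₁ ≡ suc e → DPath e₁ e' → DPath e e'

  edgesD : ∀ {e e'} → DPath e e' → List E
  edgesD (one e) = e ∷ []
  edgesD (more {e} _ P) = e ∷ edgesD P

  Visible : E → E → Set
  Visible e e' = Σ (DPath e e') λ P →
                   (e'' : E) → e'' ∈ edgesD P → e'' ≢ e' → ¬ (f e' < f e'')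

  -- membership in the visibility sequence L(e) (as a set of labels)
  _∈L_ : ℕ → E → Set
  x ∈L e = ∃ λ e' → Visible e e' × f e' ≡ x

  _∈S_ : ℕ → V → Set
  x ∈S u = ∃ λ e → par e ≡ u × x ∈L e

  -- (1): the edge entering the non-root vertex suc i is edge i
  Cond1 : Set
  Cond1 = (i : E) → ¬ (f i ∈S suc i) ⊎ f i ≡ 0

  Cond2 : Set
  Cond2 = (u : V) (e e' : E) → par e ≡ u → par e' ≡ u → e ≢ e' →
          (x : ℕ) → x ∈L e → x ∈L e' → x ≡ 0

-- A simple path between two edges of a rooted tree climbs from the first edge to a highest
-- vertex and then descends to the second, so it is either a directed path or two directed paths
-- hanging from sibling edges. Call such a path flat if no label on it exceeds the (equal) labels
-- of its end edges; f is valid exactly when every flat path has label 0 at its ends. A flat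
-- directed path from e down to e' makes f e' visible from the edge below e, violating (1); a flat
-- path through sibling edges puts its label into both of their visibility sequences, violating
-- (2). Conversely, violations of (1) and (2) are turned into flat paths of these two kinds.
module Submission where

open import Defs
open import Data.Nat using (ℕ; suc; _≤_)
open import Data.Fin using (Fin)
open import Data.Product using (_×_)
open import Function.Bundles using (_⇔_)

open import Data.Nat using (_<_; _<?_; _≟_)
open import Data.Nat.Properties using (≤-refl; ≤-trans; m≤n⇒m≤1+n; <-irrefl; <⇒≢; n≢0⇒n>0)
open import Data.Fin using (suc; toℕ)
import Data.Fin.Properties as Fin
open import Data.List using (List; []; _∷_; _ʳ++_; head; last)
open import Data.List.Relation.Unary.All as All using (All; []; _∷_)
open import Data.List.Relation.Unary.Any using (here; there; any?)
open import Data.List.Relation.Unary.Any.Properties using (reverseAcc⁻)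
open import Data.List.Relation.Unary.AllPairs using ([]; _∷_)
open import Data.List.Relation.Unary.Unique.Propositional using (Unique)
open import Data.List.Relation.Unary.Unique.Propositional.Properties using (Unique[x∷xs]⇒x∉xs)
open import Data.List.Membership.Propositional using (_∈_; find; lose)
open import Data.List.Relation.Binary.Subset.Propositional using (_⊆_)
open import Data.List.Relation.Binary.Subset.Propositional.Properties using (∈-∷⁺ʳ)
open import Data.Maybe using (just)
open import Data.Product using (Σ; _,_; proj₁)
open import Data.Sum using (_⊎_; inj₁; inj₂)
open import Data.Empty using (⊥; ⊥-elim)
open import Relation.Binary.PropositionalEquality using (_≡_; _≢_; refl; sym; trans; cong; subst)
open import Relation.Nullary using (¬_; yes; no)
open import Function.Bundles using (mk⇔; Equivalence)

module _ {A : Set} where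

  last-∷ : ∀ x (ys : List A) {z} → last ys ≡ just z → last (x ∷ ys) ≡ just z
  last-∷ x (y ∷ ys) eq = eq

  last-ʳ++ : ∀ (xs : List A) {ys z} → last ys ≡ just z → last (xs ʳ++ ys) ≡ just z
  last-ʳ++ []       eq = eq
  last-ʳ++ (x ∷ xs) {ys} eq = last-ʳ++ xs (last-∷ x ys eq)

  head-ʳ++ : ∀ (xs : List A) {ys z} → last xs ≡ just z → head (xs ʳ++ ys) ≡ just z
  head-ʳ++ (x ∷ [])     refl = refl
  head-ʳ++ (x ∷ y ∷ xs) eq   = head-ʳ++ (y ∷ xs) eq

module LabelledTree {n : ℕ} (par : Fin n → Fin (suc n)) (parent-smaller : IsParentArray par)
                    (f : Fin n → ℕ) where

  open Tree par f

  data _≼_ (a : V) : V → Set where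
    ≼-refl  : a ≼ a
    ≼-child : ∀ {e} → a ≼ par e → a ≼ suc e

  ≼-trans : ∀ {a b c} → a ≼ b → b ≼ c → a ≼ c
  ≼-trans a≼b ≼-refl        = a≼b
  ≼-trans a≼b (≼-child b≼c) = ≼-child (≼-trans a≼b b≼c)

  ≼⇒≤ : ∀ {a b} → a ≼ b → toℕ a ≤ toℕ b
  ≼⇒≤ ≼-refl              = ≤-refl
  ≼⇒≤ (≼-child {e} a≼par) = m≤n⇒m≤1+n (≤-trans (≼⇒≤ a≼par) (parent-smaller e))

  child⋠parent : ∀ e → ¬ suc e ≼ par e
  child⋠parent e d = <-irrefl refl (≤-trans (≼⇒≤ d) (parent-smaller e))

  ≼-edge : ∀ {e e₁} → par e₁ ≡ suc e → suc e ≼ suc e₁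
  ≼-edge q = ≼-child (subst (_ ≼_) (sym q) ≼-refl)

  DPath⇒≼ : ∀ {e e'} → DPath e e' → suc e ≼ suc e'
  DPath⇒≼ (one e)    = ≼-refl
  DPath⇒≼ (more q P) = ≼-trans (≼-edge q) (DPath⇒≼ P)

  ≼-comparable : ∀ {a b w} → a ≼ w → b ≼ w → a ≼ b ⊎ b ≼ a
  ≼-comparable ≼-refl        b≼w           = inj₂ b≼w
  ≼-comparable (≼-child a≼w) ≼-refl        = inj₁ (≼-child a≼w)
  ≼-comparable (≼-child a≼w) (≼-child b≼w) = ≼-comparable a≼w b≼w

  sibling-subtrees-disjoint : ∀ {a b y} → par a ≡ par b → a ≢ b → suc a ≼ y → suc b ≼ y → ⊥
  sibling-subtrees-disjoint {a} {b} pab a≢b a≼y b≼y with ≼-comparable a≼y b≼y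
  ... | inj₁ ≼-refl      = a≢b refl
  ... | inj₁ (≼-child d) = child⋠parent a (subst (_ ≼_) (sym pab) d)
  ... | inj₂ ≼-refl      = a≢b refl
  ... | inj₂ (≼-child d) = child⋠parent b (subst (_ ≼_) pab d)

  start∈verts : ∀ {u w} (W : Walk u w) → u ∈ verts W
  start∈verts (stop _)     = here refl
  start∈verts (step _ _ _) = here refl

  last-edgesD : ∀ {e e'} (P : DPath e e') → last (edgesD P) ≡ just e'
  last-edgesD (one e)        = refl
  last-edgesD (more {e} _ P) = last-∷ e (edgesD P) (last-edgesD P)

  Capped : ℕ → List E → Set
  Capped c L = ∀ {z} → z ∈ L → ¬ c < f z

  capped-⊆ : ∀ {c xs ys} → xs ⊆ ys → Capped c ys → Capped c xs
  capped-⊆ xs⊆ys capped z∈ = capped (xs⊆ys z∈)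

  capped-ʳ++ : ∀ {c xs ys} → Capped c xs → Capped c ys → Capped c (xs ʳ++ ys)
  capped-ʳ++ {xs = xs} {ys} cxs cys z∈ with reverseAcc⁻ ys xs z∈
  ... | inj₁ z∈ys = cys z∈ys
  ... | inj₂ z∈xs = cxs z∈xs

  visible : ∀ {e e'} (P : DPath e e') → Capped (f e') (edgesD P) → Visible e e'
  visible P capped = P , λ _ z∈ _ → capped z∈

  visible⇒capped : ∀ {e e'} (v : Visible e e') → Capped (f e') (edgesD (proj₁ v))
  visible⇒capped {e' = e'} (P , invisible) {z} z∈ lt with z Fin.≟ e'
  ... | yes refl = <-irrefl refl lt
  ... | no z≢e'  = invisible z z∈ z≢e' lt

  NoFlatPath : Set
  NoFlatPath = ∀ {e₁ e₂} → e₁ ≢ e₂ → f e₁ ≡ f e₂ → (S : SimplePath e₁ e₂) →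
               Capped (f e₁) (edgesW (SimplePath.walk S)) → f e₁ ≡ 0

  valid⇔noFlatPath : Valid ⇔ NoFlatPath
  valid⇔noFlatPath = mk⇔ to from
    where
    to : Valid → NoFlatPath
    to valid {e₁} {e₂} e₁≢e₂ f₁≡f₂ S capped with f e₁ ≟ 0
    ... | yes f₁≡0 = f₁≡0
    ... | no f₁≢0 with valid e₁ e₂ e₁≢e₂ f₁≡f₂ (n≢0⇒n>0 f₁≢0) S
    ...   | _ , e₃∈ , lt = ⊥-elim (capped e₃∈ lt)

    from : NoFlatPath → Valid
    from noFlat e₁ e₂ e₁≢e₂ f₁≡f₂ 0<f₁ S
      with any? (λ z → f e₁ <? f z) (edgesW (SimplePath.walk S))
    ... | yes higher = find higher
    ... | no ¬higher =
      ⊥-elim (<⇒≢ 0<f₁ (sym (noFlat e₁≢e₂ f₁≡f₂ S (λ z∈ lt → ¬higher (lose z∈ lt)))))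

  walkDown : ∀ {e e' v} → par e ≡ v → DPath e e' → Walk v (suc e')
  walkBelow : ∀ {e e'} → DPath e e' → Walk (suc e) (suc e')

  walkDown {e} p P = step e (inj₁ (p , refl)) (walkBelow P)

  walkBelow (one e)    = stop (suc e)
  walkBelow (more q P) = walkDown q P

  edgesW-walkDown : ∀ {e e' v} (p : par e ≡ v) (P : DPath e e') → edgesW (walkDown p P) ≡ edgesD P
  edgesW-walkDown p (one e)        = refl
  edgesW-walkDown p (more {e} q P) = cong (e ∷_) (edgesW-walkDown q P)

  walkBelow-verts : ∀ {e e'} (P : DPath e e') → All (suc e ≼_) (verts (walkBelow P))
  walkBelow-verts (one e)    = ≼-refl ∷ []
  walkBelow-verts (more q P) = ≼-refl ∷ All.map (≼-trans (≼-edge q)) (walkBelow-verts P)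

  walkDown-unique : ∀ {e e' v} (p : par e ≡ v) (P : DPath e e') → ¬ suc e ≼ v →
                    Unique (verts (walkDown p P))
  walkBelow-unique : ∀ {e e'} (P : DPath e e') → Unique (verts (walkBelow P))

  walkDown-unique {e} p P e⋠v =
    All.map (λ e≼y v≡y → e⋠v (subst (suc e ≼_) (sym v≡y) e≼y)) (walkBelow-verts P)
    ∷ walkBelow-unique P

  walkBelow-unique (one e)              = [] ∷ []
  walkBelow-unique (more {e₁ = e₁} q P) =
    walkDown-unique q P (λ d → child⋠parent e₁ (subst (_ ≼_) (sym q) d))

  climb : ∀ {e e' v t} → DPath e e' → par e ≡ v → Walk v t → Walk (suc e') t
  climb (one e)        p W = step e (inj₂ (p , refl)) W
  climb (more {e} q P) p W = climb P q (step e (inj₂ (p , refl)) W)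

  edgesW-climb : ∀ {e e' v t} (P : DPath e e') (p : par e ≡ v) (W : Walk v t) →
                 edgesW (climb P p W) ≡ edgesD P ʳ++ edgesW W
  edgesW-climb (one e)    p W = refl
  edgesW-climb (more q P) p W = edgesW-climb P q _

  climb-unique : ∀ {e e' v t} (P : DPath e e') (p : par e ≡ v) (W : Walk v t) →
                 Unique (verts W) → All (λ y → ¬ suc e ≼ y) (verts W) → Unique (verts (climb P p W))
  climb-unique (one e) p W u outside =
    All.map (λ e⋠y e≡y → e⋠y (subst (suc e ≼_) e≡y ≼-refl)) outside ∷ u
  climb-unique (more {e} {e₁} q P) p W u outside =
    climb-unique P q _
      (All.map (λ e⋠y e≡y → e⋠y (subst (suc e ≼_) e≡y ≼-refl)) outside ∷ u)
      ((λ d → child⋠parent e₁ (subst (_ ≼_) (sym q) d))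
       ∷ All.map (λ e⋠y e₁≼y → e⋠y (≼-trans (≼-edge q) e₁≼y)) outside)

  PathAlong : E → E → List E → Set
  PathAlong e₁ e₂ L = Σ (SimplePath e₁ e₂) λ S → edgesW (SimplePath.walk S) ≡ L

  noFlatPath-along : NoFlatPath → ∀ {e₁ e₂ L} → e₁ ≢ e₂ → f e₁ ≡ f e₂ →
                     PathAlong e₁ e₂ L → Capped (f e₁) L → f e₁ ≡ 0
  noFlatPath-along noFlat e₁≢e₂ f₁≡f₂ (S , edges) capped =
    noFlat e₁≢e₂ f₁≡f₂ S (subst (Capped _) (sym edges) capped)

  descentPath : ∀ {e e'} (P : DPath e e') → PathAlong e e' (edgesD P)
  descentPath {e} P = record
    { walk   = walkDown refl P
    ; simple = walkDown-unique refl P (child⋠parent e)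
    ; first  = refl
    ; final  = trans (cong last (edgesW-walkDown refl P)) (last-edgesD P)
    } , edgesW-walkDown refl P

  peakPath : ∀ {a b e₁ e₂} → par a ≡ par b → a ≢ b → (P : DPath a e₁) (Q : DPath b e₂) →
             PathAlong e₁ e₂ (edgesD P ʳ++ edgesD Q)
  peakPath {a} {b} pab a≢b P Q = record
    { walk   = climb P pab (walkDown refl Q)
    ; simple = climb-unique P pab _ (walkDown-unique refl Q (child⋠parent b)) outside
    ; first  = trans (cong head edges) (head-ʳ++ (edgesD P) (last-edgesD P))
    ; final  = trans (cong last edges) (last-ʳ++ (edgesD P) (last-edgesD Q))
    } , edges
    where
    edges : edgesW (climb P pab (walkDown refl Q)) ≡ edgesD P ʳ++ edgesD Q
    edges = trans (edgesW-climb P pab _) (cong (edgesD P ʳ++_) (edgesW-walkDown refl Q))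

    outside : All (λ y → ¬ suc a ≼ y) (verts (walkDown refl Q))
    outside = (λ d → child⋠parent a (subst (_ ≼_) (sym pab) d))
            ∷ All.map (λ b≼y a≼y → sibling-subtrees-disjoint pab a≢b a≼y b≼y) (walkBelow-verts Q)

  noFlatPath⇒cond1 : NoFlatPath → Cond1
  noFlatPath⇒cond1 noFlat i with f i ≟ 0
  ... | yes fi≡0 = inj₂ fi≡0
  ... | no fi≢0  = inj₁ λ { (c , pc , e' , vis , fe'≡fi) → fi≢0 (flat pc vis fe'≡fi) }
    where
    flat : ∀ {c e'} → par c ≡ suc i → (vis : Visible c e') → f e' ≡ f i → f i ≡ 0
    flat {c} {e'} pc vis fe'≡fi =
      noFlatPath-along noFlat i≢e' (sym fe'≡fi) (descentPath (more pc (proj₁ vis))) capped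
      where
      i≢e' : i ≢ e'
      i≢e' refl = child⋠parent c (subst (_ ≼_) (sym pc) (DPath⇒≼ (proj₁ vis)))

      capped : Capped (f i) (i ∷ edgesD (proj₁ vis))
      capped (here refl)    = <-irrefl refl
      capped {z} (there z∈) = subst (λ c → ¬ c < f z) fe'≡fi (visible⇒capped vis z∈)

  noFlatPath⇒cond2 : NoFlatPath → Cond2
  noFlatPath⇒cond2 noFlat u e e' pe pe' e≢e' x (e₁ , (P₁ , vis₁) , f₁≡x) (e₂ , (P₂ , vis₂) , f₂≡x) =
    trans (sym f₁≡x) (noFlatPath-along noFlat e₁≢e₂ f₁≡f₂ (peakPath siblings e≢e' P₁ P₂) capped)
    where
    siblings : par e ≡ par e'
    siblings = trans pe (sym pe')

    f₁≡f₂ : f e₁ ≡ f e₂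
    f₁≡f₂ = trans f₁≡x (sym f₂≡x)

    e₁≢e₂ : e₁ ≢ e₂
    e₁≢e₂ refl = sibling-subtrees-disjoint siblings e≢e' (DPath⇒≼ P₁) (DPath⇒≼ P₂)

    capped : Capped (f e₁) (edgesD P₁ ʳ++ edgesD P₂)
    capped = capped-ʳ++ (visible⇒capped (P₁ , vis₁))
                        (subst (λ c → Capped c (edgesD P₂)) (sym f₁≡f₂) (visible⇒capped (P₂ , vis₂)))

  data Shape (e₁ e₂ : E) (L : List E) : Set where
    descending : (P : DPath e₁ e₂) → edgesD P ⊆ L → Shape e₁ e₂ L
    ascending  : (P : DPath e₂ e₁) → edgesD P ⊆ L → Shape e₁ e₂ L
    peaked     : ∀ {a b} → par a ≡ par b → a ≢ b →
                 (P : DPath a e₁) → edgesD P ⊆ L → (Q : DPath b e₂) → edgesD Q ⊆ L → Shape e₁ e₂ L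

  descending-walk : ∀ {e e₂ t L} (W : Walk (suc e) t) → e ∷ edgesW W ⊆ L →
                    Unique (par e ∷ verts W) → last (e ∷ edgesW W) ≡ just e₂ →
                    Σ (DPath e e₂) λ P → edgesD P ⊆ L
  descending-walk (stop _) sub u refl = one _ , sub
  descending-walk (step e' (inj₁ (pe' , refl)) W) sub (_ ∷ u) l
    with descending-walk W (λ z∈ → sub (there z∈))
                           (subst (λ x → Unique (x ∷ verts W)) (sym pe') u) l
  ... | P , subP = more pe' P , ∈-∷⁺ʳ (sub (here refl)) subP
  descending-walk (step _ (inj₂ (refl , refl)) W) sub u l =
    ⊥-elim (Unique[x∷xs]⇒x∉xs u (there (start∈verts W)))

  -- A is the ascending part walked so far, from the current edge e down to the first edge e₁.
  rising-walk : ∀ {e e₁ e₂ t L} (A : DPath e e₁) → edgesD A ⊆ L →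
                (W : Walk (par e) t) → edgesW W ⊆ L → Unique (suc e ∷ verts W) →
                last (e ∷ edgesW W) ≡ just e₂ → Shape e₁ e₂ L
  rising-walk A subA (stop _) subW u refl = ascending A subA
  rising-walk {e} A subA (step e' (inj₁ (pe' , refl)) W) subW ((_ ∷ suc-e∉) ∷ u) l
    with descending-walk W subW (subst (λ x → Unique (x ∷ verts W)) (sym pe') u) l
  ... | Q , subQ = peaked (sym pe') e≢e' A subA Q subQ
    where
    e≢e' : e ≢ e'
    e≢e' refl = All.lookup suc-e∉ (start∈verts W) refl
  rising-walk A subA (step e' (inj₂ (refl , se')) W) subW (_ ∷ u) l =
    rising-walk (more (sym se') A) (∈-∷⁺ʳ (subW (here refl)) subA) W (λ z∈ → subW (there z∈))
                (subst (λ x → Unique (x ∷ verts W)) (sym se') u) l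

  shape : ∀ {s t e₁ e₂} (W : Walk s t) → Unique (verts W) →
          head (edgesW W) ≡ just e₁ → last (edgesW W) ≡ just e₂ → Shape e₁ e₂ (edgesW W)
  shape (step e (inj₁ (refl , refl)) W) u refl l with descending-walk W (λ z∈ → z∈) u l
  ... | P , subP = descending P subP
  shape (step e (inj₂ (refl , refl)) W) u refl l =
    rising-walk (one e) (∈-∷⁺ʳ (here refl) (λ ())) W there u l

  cond1⇒no-visible-descendant : Cond1 → ∀ {e e'} (P : DPath e e') → e ≢ e' →
                                 Capped (f e') (edgesD P) → f e ≡ f e' → f e ≡ 0
  cond1⇒no-visible-descendant c1 (one e) e≢e = ⊥-elim (e≢e refl)
  cond1⇒no-visible-descendant c1 {e} (more {e₁ = c} pc P) _ capped fe≡fe' with c1 e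
  ... | inj₂ fe≡0 = fe≡0
  ... | inj₁ fe∉S = ⊥-elim (fe∉S (c , pc , _ , visible P (capped-⊆ there capped) , sym fe≡fe'))

  conditions⇒noFlatPath : Cond1 → Cond2 → NoFlatPath
  conditions⇒noFlatPath c1 c2 {e₁} {e₂} e₁≢e₂ f₁≡f₂ S capped
    with shape (SimplePath.walk S) (SimplePath.simple S) (SimplePath.first S) (SimplePath.final S)
  ... | descending P sub =
    cond1⇒no-visible-descendant c1 P e₁≢e₂
      (subst (λ c → Capped c (edgesD P)) f₁≡f₂ (capped-⊆ sub capped)) f₁≡f₂
  ... | ascending P sub =
    trans f₁≡f₂ (cond1⇒no-visible-descendant c1 P (λ e₂≡e₁ → e₁≢e₂ (sym e₂≡e₁))
                   (capped-⊆ sub capped) (sym f₁≡f₂))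
  ... | peaked pab a≢b P subP Q subQ =
    c2 _ _ _ refl (sym pab) a≢b (f e₁)
       (e₁ , visible P (capped-⊆ subP capped) , refl)
       (e₂ , visible Q (subst (λ c → Capped c (edgesD Q)) f₁≡f₂ (capped-⊆ subQ capped))
           , sym f₁≡f₂)

proposition4p2 : (n k : ℕ) (par : Fin n → Fin (suc n)) → IsParentArray par →
    (f : Fin n → ℕ) → ((e : Fin n) → f e ≤ k) →
    Tree.Valid par f ⇔ (Tree.Cond1 par f × Tree.Cond2 par f)
proposition4p2 n k par parent-smaller f _ = mk⇔
  (λ valid → let noFlat = Equivalence.to valid⇔noFlatPath valid in
             noFlatPath⇒cond1 noFlat , noFlatPath⇒cond2 noFlat)
  (λ (c1 , c2) → Equivalence.from valid⇔noFlatPath (conditions⇒noFlatPath c1 c2))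
  where open LabelledTree par parent-smaller f
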